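{- Let $m,n\ge 3$ be integers and $G=K_m\Box K_n$. Then $cs(G)=\alpha(m,n)$, where \[ \alpha(m,n) = \min\left\{mn-\sum_{i=1}^2m_in_i +\max\left\{\left\lceil\frac{\max\{m_1n_1,m_2n_2\} - mn+\sum_{i=1}^2m_in_i}{2}\right\rceil ,1 \right\} \right\}, \] the minimum being taken over all $((m_1,m_2),(n_1,n_2))$ with $m_1,m_2,n_1,n_2$ positive integers, $m_1+m_2=m$ and $n_1+n_2=n$.
   Context: For a connected graph $G$ and $X\subseteq V(G)$, $G[X]$ denotes the subgraph induced by $X$. A set $S\subseteq V(G)$ is a safe set if for every component $C$ of $G[S]$ and every component $D$ of $G-S$ such that some edge joins $C$ and $D$, we have $|C|\ge |D|$. If moreover $G[S]$ is connected, $S$ is a connected safe set. The connected safe number $cs(G)$ is the minimum size of a connected safe set of $G$. $K_m \Box K_n$ has vertex set $[m]\times[n]$, with $(i,j)$ and $(i',j')$ adjacent iff either $i=i'$ and $j\neq j'$, or $j=j'$ and $i\ne i'$. -}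

module Defs where

open import Data.Nat using (ℕ; zero; suc; _+_; _*_; _∸_; _≤_; _⊔_; ⌈_/2⌉)
open import Data.Fin using (Fin)
open import Data.Bool using (Bool; true; false; T; not; if_then_else_)
open import Data.List using (List; map; allFin)
open import Data.Nat.ListAction using (sum)
open import Data.Product using (_×_; Σ; ∃; ∃-syntax; _,_)
open import Data.Sum using (_⊎_)
open import Relation.Binary.PropositionalEquality using (_≡_; _≢_)

V : ℕ → ℕ → Set
V m n = Fin m × Fin n

Adj : ∀ {m n} → V m n → V m n → Set
Adj (i , j) (i' , j') = (i ≡ i' × j ≢ j') ⊎ (j ≡ j' × i ≢ i')

VSet : ℕ → ℕ → Set
VSet m n = V m n → Bool

_∈ˢ_ : ∀ {m n} → V m n → VSet m n → Set
v ∈ˢ X = T (X v)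

compl : ∀ {m n} → VSet m n → VSet m n
compl X v = not (X v)

_⊆ˢ_ : ∀ {m n} → VSet m n → VSet m n → Set
C ⊆ˢ X = ∀ v → v ∈ˢ C → v ∈ˢ X

size : ∀ {m n} → VSet m n → ℕ
size {m} {n} X =
  sum (map (λ i → sum (map (λ j → if X (i , j) then 1 else 0) (allFin n))) (allFin m))

data Walk {m n} (C : VSet m n) : V m n → V m n → Set where
  here : ∀ {v} → v ∈ˢ C → Walk C v v
  step : ∀ {u v w} → u ∈ˢ C → Adj u v → Walk C v w → Walk C u w

Connected : ∀ {m n} → VSet m n → Set
Connected C = (∃[ v ] v ∈ˢ C) × (∀ u v → u ∈ˢ C → v ∈ˢ C → Walk C u v)

-- C is (the vertex set of) a component of G[X]: a maximal connected
-- vertex subset of X, i.e. connected, inside X, and closed under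
-- adjacency within X.
IsComponent : ∀ {m n} → VSet m n → VSet m n → Set
IsComponent X C =
  C ⊆ˢ X × Connected C ×
  (∀ u v → u ∈ˢ C → v ∈ˢ X → Adj u v → v ∈ˢ C)

Joined : ∀ {m n} → VSet m n → VSet m n → Set
Joined C D = ∃[ u ] ∃[ v ] (u ∈ˢ C × v ∈ˢ D × Adj u v)

IsSafe : ∀ {m n} → VSet m n → Set
IsSafe S = ∀ C D → IsComponent S C → IsComponent (compl S) D →
           Joined C D → size D ≤ size C

IsConnectedSafe : ∀ {m n} → VSet m n → Set
IsConnectedSafe S = IsSafe S × Connected S

IsMinimum : (ℕ → Set) → ℕ → Set
IsMinimum P k = P k × (∀ j → P j → k ≤ j)

CSSize : ℕ → ℕ → ℕ → Set
CSSize m n k = Σ (VSet m n) λ S → IsConnectedSafe S × size S ≡ k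

-- Since m*n ≥ m1*n1 + m2*n2, the first
-- truncated subtraction is exact; in the second, a negative numerator is
-- truncated to 0, which is harmless because of the outer max with 1.
αterm : ℕ → ℕ → ℕ → ℕ → ℕ → ℕ → ℕ
αterm m n m₁ m₂ n₁ n₂ =
  (m * n ∸ (m₁ * n₁ + m₂ * n₂)) +
  (⌈ ((m₁ * n₁) ⊔ (m₂ * n₂)) + (m₁ * n₁ + m₂ * n₂) ∸ m * n /2⌉ ⊔ 1)

AlphaVal : ℕ → ℕ → ℕ → Set
AlphaVal m n v =
  ∃[ m₁ ] ∃[ m₂ ] ∃[ n₁ ] ∃[ n₂ ]
    (1 ≤ m₁ × 1 ≤ m₂ × 1 ≤ n₁ × 1 ≤ n₂ ×
     m₁ + m₂ ≡ m × n₁ + n₂ ≡ n × v ≡ αterm m n m₁ m₂ n₁ n₂)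

module Submission where

-- Let S be a connected safe set with complement T. In K_m □ K_n every component of G[T]
-- is a block T ∩ (R × C) with T ⊆ (R × C) ∪ (R̄ × C̄), and peeling T apart component by
-- component yields one, D, with 2|T| ≤ |R||C| + mn. The mixed blocks R × C̄ and R̄ × C then
-- lie in S, so |S| = |R||C̄| + |R̄||C| + x where x counts the vertices of S in the diagonal
-- blocks, and safety (|D| ≤ |S|) turns the bound on |T| into |R||C|, |R̄||C̄| ≤ |S| + x, i.e.
-- |S| is at least the α-term of the split (|R| , |R̄|), (|C| , |C̄|). If T fits in a single
-- diagonal block, safety gives mn ≤ 2|S| and the split (1 , m − 1), (1 , n − 1) suffices.
-- Conversely, if |R||C| ≥ |R̄||C̄|, then R × C̄ ∪ R̄ × C together with any x vertices of
-- R × C, for x the optimal value max(⌈(|R||C| − |R||C̄| − |R̄||C|)/2⌉, 1), is a connected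
-- safe set realising the α-term of that split.

open import Defs
open import Data.Nat using (ℕ; _≤_)
open import Data.Product using (_×_; ∃-syntax)

open import Data.Bool using (Bool; true; false; T; not; if_then_else_; _∧_; _∨_; _xor_)
open import Data.Bool.Properties using (T?; ¬-not; ∧-identityʳ; not-involutive) renaming (_≟_ to _≟ᵇ_)
open import Data.Empty using (⊥; ⊥-elim)
open import Data.Fin using (Fin; zero; suc; toℕ)
open import Data.Fin.Properties using (_≟_; any?; suc-injective)
open import Data.List using (List; []; _∷_; map; tabulate; cartesianProduct; applyUpTo)
open import Data.List.Extrema.Nat using (argmin; argmin-all; f[argmin]≤f[xs])
open import Data.List.Membership.Propositional using (_∈_)
open import Data.List.Membership.Propositional.Properties
  using (∈-cartesianProduct⁺; ∈-cartesianProduct⁻; ∈-applyUpTo⁺; ∈-applyUpTo⁻)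
import Data.List.Relation.Unary.All as All
open import Data.Nat using (zero; suc; pred; _+_; _*_; _∸_; _<_; _<ᵇ_; _⊓_; _⊔_; ⌈_/2⌉; z≤n; s≤s)
import Data.Nat.ListAction as List
open import Data.Nat.Properties hiding (_≟_; suc-injective)
open import Algebra.Properties.Semiring.Sum +-*-semiring
  using (sum; ∑-distrib-+; sum-cong-≗; *-distribˡ-sum; *-distribʳ-sum)
open import Data.Nat.Tactic.RingSolver using (solve)
open import Data.Product using (Σ; ∃; _,_; proj₁; proj₂; uncurry)
open import Data.Sum using (_⊎_; inj₁; inj₂)
open import Data.Unit using (tt)
open import Function using (_∘_; id)
open import Relation.Binary.PropositionalEquality
open import Relation.Nullary using (¬_; Dec; yes; no; ¬?; _×-dec_; contradiction)
open import Relation.Nullary.Decidable using (⌊_⌋; toWitness; fromWitness; ⌊⌋-map′)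

𝟙 : Bool → ℕ
𝟙 b = if b then 1 else 0

sum-mono-≤ : ∀ {k} {f g : Fin k → ℕ} → (∀ i → f i ≤ g i) → sum f ≤ sum g
sum-mono-≤ {zero}  f≤g = z≤n
sum-mono-≤ {suc k} f≤g = +-mono-≤ (f≤g zero) (sum-mono-≤ (f≤g ∘ suc))

sum-mono-< : ∀ {k} {f g : Fin k → ℕ} → (∀ i → f i ≤ g i) → ∀ i → f i < g i → sum f < sum g
sum-mono-< f≤g zero    f<g = +-mono-<-≤ f<g (sum-mono-≤ (f≤g ∘ suc))
sum-mono-< f≤g (suc i) f<g = +-mono-≤-< (f≤g zero) (sum-mono-< (f≤g ∘ suc) i f<g)

sum-const : ∀ k c → sum {k} (λ _ → c) ≡ k * c
sum-const zero    c = refl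
sum-const (suc k) c = cong (c +_) (sum-const k c)

term≤sum : ∀ {k} (f : Fin k → ℕ) i → f i ≤ sum f
term≤sum f zero    = m≤m+n _ _
term≤sum f (suc i) = ≤-trans (term≤sum (f ∘ suc) i) (m≤n+m _ _)

sum-pos⇒∃ : ∀ {k} (f : Fin k → ℕ) → 0 < sum f → ∃[ i ] 0 < f i
sum-pos⇒∃ {suc k} f pos with f zero in eq
... | suc _ = zero , subst (0 <_) (sym eq) (s≤s z≤n)
... | zero with sum-pos⇒∃ (f ∘ suc) pos
...   | i , fi>0 = suc i , fi>0

list-sum-tabulate : ∀ {A : Set} k (h : Fin k → A) (g : A → ℕ) →
  List.sum (map g (tabulate h)) ≡ sum (g ∘ h)
list-sum-tabulate zero    h g = refl
list-sum-tabulate (suc k) h g = cong (g (h zero) +_) (list-sum-tabulate k (h ∘ suc) g)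

T-ext : ∀ {a b} → (T a → T b) → (T b → T a) → a ≡ b
T-ext {true}  {true}  _   _   = refl
T-ext {true}  {false} a⇒b _   = ⊥-elim (a⇒b tt)
T-ext {false} {true}  _   b⇒a = ⊥-elim (b⇒a tt)
T-ext {false} {false} _   _   = refl

∧-intro : ∀ {a b} → T a → T b → T (a ∧ b)
∧-intro {true} {true} _ _ = tt

∧-elimˡ : ∀ {a b} → T (a ∧ b) → T a
∧-elimˡ {true} _ = tt

∧-elimʳ : ∀ {a b} → T (a ∧ b) → T b
∧-elimʳ {true} p = p

not⁺ : ∀ {a} → ¬ T a → T (not a)
not⁺ {true}  ¬a = ¬a tt
not⁺ {false} _  = tt

not⁻ : ∀ {a} → T (not a) → ¬ T a
not⁻ {true} ()

∨-introˡ : ∀ {a b} → T a → T (a ∨ b)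
∨-introˡ {true} _ = tt

∨-introʳ : ∀ a {b} → T b → T (a ∨ b)
∨-introʳ true  _ = tt
∨-introʳ false b = b

∨-elim : ∀ a {b} → T (a ∨ b) → T a ⊎ T b
∨-elim true  _ = inj₁ tt
∨-elim false b = inj₂ b

𝟙-mono : ∀ {a b} → (T a → T b) → 𝟙 a ≤ 𝟙 b
𝟙-mono {false}         _   = z≤n
𝟙-mono {true} {true}   _   = ≤-refl
𝟙-mono {true} {false}  a⇒b = ⊥-elim (a⇒b tt)

𝟙-pos : ∀ {a} → T a → 0 < 𝟙 a
𝟙-pos {true} _ = s≤s z≤n

¬T⇒𝟙≡0 : ∀ {a} → ¬ T a → 𝟙 a ≡ 0
¬T⇒𝟙≡0 {true}  ¬a = ⊥-elim (¬a tt)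
¬T⇒𝟙≡0 {false} _  = refl

𝟙-pos⁻ : ∀ a → 0 < 𝟙 a → T a
𝟙-pos⁻ true _ = tt

𝟙-≤1 : ∀ a → 𝟙 a ≤ 1
𝟙-≤1 true  = ≤-refl
𝟙-≤1 false = z≤n

𝟙-not : ∀ a → 𝟙 a + 𝟙 (not a) ≡ 1
𝟙-not true  = refl
𝟙-not false = refl

count : ∀ {k} → (Fin k → Bool) → ℕ
count P = sum (𝟙 ∘ P)

count≤ : ∀ {k} (P : Fin k → Bool) → count P ≤ k
count≤ {k} P = begin
  count P        ≤⟨ sum-mono-≤ (𝟙-≤1 ∘ P) ⟩
  sum {k} (λ _ → 1)  ≡⟨ sum-const k 1 ⟩
  k * 1          ≡⟨ *-identityʳ k ⟩
  k              ∎
  where open ≤-Reasoning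

count-not : ∀ {k} (P : Fin k → Bool) → count P + count (not ∘ P) ≡ k
count-not {k} P = begin
  count P + count (not ∘ P)  ≡⟨ ∑-distrib-+ (𝟙 ∘ P) (𝟙 ∘ not ∘ P) ⟨
  sum (λ i → 𝟙 (P i) + 𝟙 (not (P i)))  ≡⟨ sum-cong-≗ (𝟙-not ∘ P) ⟩
  sum {k} (λ _ → 1)  ≡⟨ sum-const k 1 ⟩
  k * 1          ≡⟨ *-identityʳ k ⟩
  k              ∎
  where open ≡-Reasoning

count-all : ∀ k → count {k} (λ _ → true) ≡ k
count-all k = trans (sum-const k 1) (*-identityʳ k)

count-mono : ∀ {k} {P Q : Fin k → Bool} → (∀ i → T (P i) → T (Q i)) → count P ≤ count Q
count-mono P⊆Q = sum-mono-≤ (λ i → 𝟙-mono (P⊆Q i))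

count-mono-< : ∀ {k} {P Q : Fin k → Bool} → (∀ i → T (P i) → T (Q i)) →
  ∀ i → ¬ T (P i) → T (Q i) → count P < count Q
count-mono-< {P = P} P⊆Q i i∉P i∈Q =
  sum-mono-< (λ i → 𝟙-mono (P⊆Q i)) i (subst (_< _) (sym (¬T⇒𝟙≡0 i∉P)) (𝟙-pos i∈Q))

∈⇒count-pos : ∀ {k} (P : Fin k → Bool) {i} → T (P i) → 0 < count P
∈⇒count-pos P {i} i∈P = <-≤-trans (𝟙-pos i∈P) (term≤sum (𝟙 ∘ P) i)

count-pos⇒∈ : ∀ {k} (P : Fin k → Bool) → 0 < count P → ∃[ i ] T (P i)
count-pos⇒∈ P pos with sum-pos⇒∃ (𝟙 ∘ P) pos
... | i , 𝟙>0 = i , 𝟙-pos⁻ (P i) 𝟙>0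

count-<ᵇ : ∀ k a → a ≤ k → count {k} (λ i → toℕ i <ᵇ a) ≡ a
count-<ᵇ zero    zero    _         = refl
count-<ᵇ (suc k) zero    _         = trans (sum-const k 0) (*-zeroʳ k)
count-<ᵇ (suc k) (suc a) (s≤s a≤k) = cong suc (count-<ᵇ k a a≤k)

∑V : ∀ {m n} → (V m n → ℕ) → ℕ
∑V f = sum λ i → sum λ j → f (i , j)

∑V-cong : ∀ {m n} {f g : V m n → ℕ} → (∀ v → f v ≡ g v) → ∑V f ≡ ∑V g
∑V-cong f≗g = sum-cong-≗ λ i → sum-cong-≗ λ j → f≗g (i , j)

∑V-distrib-+ : ∀ {m n} (f g : V m n → ℕ) → ∑V (λ v → f v + g v) ≡ ∑V f + ∑V g
∑V-distrib-+ f g =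
  trans (sum-cong-≗ λ i → ∑-distrib-+ (λ j → f (i , j)) (λ j → g (i , j))) (∑-distrib-+ (λ i → sum λ j → f (i , j)) (λ i → sum λ j → g (i , j)))

∑V-mono-≤ : ∀ {m n} {f g : V m n → ℕ} → (∀ v → f v ≤ g v) → ∑V f ≤ ∑V g
∑V-mono-≤ f≤g = sum-mono-≤ λ i → sum-mono-≤ λ j → f≤g (i , j)

∑V-pos⇒∃ : ∀ {m n} (f : V m n → ℕ) → 0 < ∑V f → ∃[ v ] 0 < f v
∑V-pos⇒∃ f pos with sum-pos⇒∃ _ pos
... | i , posᵢ with sum-pos⇒∃ _ posᵢ
...   | j , posᵢⱼ = (i , j) , posᵢⱼ

term≤∑V : ∀ {m n} (f : V m n → ℕ) v → f v ≤ ∑V f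
term≤∑V f (i , j) = ≤-trans (term≤sum (λ j → f (i , j)) j) (term≤sum (λ i → sum λ j → f (i , j)) i)

∑V-product : ∀ {m n} (g : Fin m → ℕ) (h : Fin n → ℕ) → ∑V (λ v → g (proj₁ v) * h (proj₂ v)) ≡ sum g * sum h
∑V-product g h = begin
  (sum λ i → sum λ j → g i * h j)  ≡⟨ sum-cong-≗ (λ i → *-distribˡ-sum (g i) h) ⟨
  (sum λ i → g i * sum h)          ≡⟨ *-distribʳ-sum (sum h) g ⟨
  sum g * sum h                    ∎
  where open ≡-Reasoning

size≡∑V : ∀ {m n} (X : VSet m n) → size X ≡ ∑V (𝟙 ∘ X)
size≡∑V {m} {n} X =
  trans (list-sum-tabulate m id _)
    (sum-cong-≗ λ i → list-sum-tabulate n id (λ j → if X (i , j) then 1 else 0))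

rect : ∀ {m n} → (Fin m → Bool) → (Fin n → Bool) → VSet m n
rect R C v = R (proj₁ v) ∧ C (proj₂ v)

block : ∀ {m n} → VSet m n → (Fin m → Bool) → (Fin n → Bool) → VSet m n
block X R C v = X v ∧ rect R C v

size-≗ : ∀ {m n} {X Y : VSet m n} → (∀ v → X v ≡ Y v) → size X ≡ size Y
size-≗ {X = X} {Y} X≗Y = begin
  size X      ≡⟨ size≡∑V X ⟩
  ∑V (𝟙 ∘ X)  ≡⟨ ∑V-cong (cong 𝟙 ∘ X≗Y) ⟩
  ∑V (𝟙 ∘ Y)  ≡⟨ size≡∑V Y ⟨
  size Y      ∎
  where open ≡-Reasoning

size-⊎ : ∀ {m n} {X Y Z : VSet m n} → (∀ v → 𝟙 (Z v) ≡ 𝟙 (X v) + 𝟙 (Y v)) →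
  size Z ≡ size X + size Y
size-⊎ {X = X} {Y} {Z} Z≗X⊎Y = begin
  size Z                              ≡⟨ size≡∑V Z ⟩
  ∑V (𝟙 ∘ Z)                          ≡⟨ ∑V-cong Z≗X⊎Y ⟩
  ∑V (λ v → 𝟙 (X v) + 𝟙 (Y v))        ≡⟨ ∑V-distrib-+ (𝟙 ∘ X) (𝟙 ∘ Y) ⟩
  ∑V (𝟙 ∘ X) + ∑V (𝟙 ∘ Y)             ≡⟨ cong₂ _+_ (size≡∑V X) (size≡∑V Y) ⟨
  size X + size Y                     ∎
  where open ≡-Reasoning

size-mono : ∀ {m n} {X Y : VSet m n} → X ⊆ˢ Y → size X ≤ size Y
size-mono {X = X} {Y} X⊆Y = begin
  size X      ≡⟨ size≡∑V X ⟩
  ∑V (𝟙 ∘ X)  ≤⟨ ∑V-mono-≤ (λ v → 𝟙-mono (X⊆Y v)) ⟩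
  ∑V (𝟙 ∘ Y)  ≡⟨ size≡∑V Y ⟨
  size Y      ∎
  where open ≤-Reasoning

size-disjoint-⊆ : ∀ {m n} {X Y Z : VSet m n} → (∀ v → v ∈ˢ X → v ∈ˢ Y → ⊥) →
  X ⊆ˢ Z → Y ⊆ˢ Z → size X + size Y ≤ size Z
size-disjoint-⊆ {X = X} {Y} {Z} disjoint X⊆Z Y⊆Z = begin
  size X + size Y                ≡⟨ cong₂ _+_ (size≡∑V X) (size≡∑V Y) ⟩
  ∑V (𝟙 ∘ X) + ∑V (𝟙 ∘ Y)        ≡⟨ ∑V-distrib-+ (𝟙 ∘ X) (𝟙 ∘ Y) ⟨
  ∑V (λ v → 𝟙 (X v) + 𝟙 (Y v))   ≤⟨ ∑V-mono-≤ (λ v → pointwise (X v) (Y v) (Z v) (disjoint v) (X⊆Z v) (Y⊆Z v)) ⟩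
  ∑V (𝟙 ∘ Z)                     ≡⟨ size≡∑V Z ⟨
  size Z                         ∎
  where
  open ≤-Reasoning
  pointwise : ∀ x y z → (T x → T y → ⊥) → (T x → T z) → (T y → T z) → 𝟙 x + 𝟙 y ≤ 𝟙 z
  pointwise true  true  _     x∩y  _   _   = ⊥-elim (x∩y tt tt)
  pointwise true  false z     _    x⇒z _   = ≤-trans (≤-reflexive (+-identityʳ 1)) (𝟙-mono x⇒z)
  pointwise false y     z     _    _   y⇒z = 𝟙-mono y⇒z

size-rect : ∀ {m n} (R : Fin m → Bool) (C : Fin n → Bool) → size (rect R C) ≡ count R * count C
size-rect R C = begin
  size (rect R C)                                   ≡⟨ size≡∑V (rect R C) ⟩
  ∑V (λ v → 𝟙 (R (proj₁ v) ∧ C (proj₂ v)))          ≡⟨ ∑V-cong (λ v → 𝟙-∧ (R (proj₁ v)) (C (proj₂ v))) ⟩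
  ∑V (λ v → 𝟙 (R (proj₁ v)) * 𝟙 (C (proj₂ v)))      ≡⟨ ∑V-product (𝟙 ∘ R) (𝟙 ∘ C) ⟩
  count R * count C                                 ∎
  where
  open ≡-Reasoning
  𝟙-∧ : ∀ a b → 𝟙 (a ∧ b) ≡ 𝟙 a * 𝟙 b
  𝟙-∧ true  true  = refl
  𝟙-∧ true  false = refl
  𝟙-∧ false _     = refl

size-empty : ∀ {m n} (X : VSet m n) → (∀ v → ¬ v ∈ˢ X) → size X ≡ 0
size-empty {m} {n} X X≡∅ = begin
  size X                          ≡⟨ size≡∑V X ⟩
  ∑V (𝟙 ∘ X)                      ≡⟨ ∑V-cong (λ v → ¬T⇒𝟙≡0 (X≡∅ v)) ⟩
  (sum {m} λ i → sum {n} λ j → 0) ≡⟨ sum-cong-≗ {m} (λ i → trans (sum-const n 0) (*-zeroʳ n)) ⟩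
  sum {m} (λ i → 0)               ≡⟨ trans (sum-const m 0) (*-zeroʳ m) ⟩
  0                               ∎
  where open ≡-Reasoning

∈⇒size-pos : ∀ {m n} (X : VSet m n) {v} → v ∈ˢ X → 0 < size X
∈⇒size-pos X {v} v∈X =
  <-≤-trans (𝟙-pos v∈X) (≤-trans (term≤∑V (𝟙 ∘ X) v) (≤-reflexive (sym (size≡∑V X))))

size-pos⇒∈ : ∀ {m n} (X : VSet m n) → 0 < size X → ∃[ v ] v ∈ˢ X
size-pos⇒∈ X pos with ∑V-pos⇒∃ (𝟙 ∘ X) (subst (0 <_) (size≡∑V X) pos)
... | v , 𝟙>0 = v , 𝟙-pos⁻ (X v) 𝟙>0

size-compl : ∀ {m n} (S : VSet m n) → size S + size (compl S) ≡ m * n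
size-compl {m} {n} S = begin
  size S + size (compl S)  ≡⟨ size-⊎ (λ v → sym (𝟙-not (S v))) ⟨
  size {m} {n} (rect (λ _ → true) (λ _ → true))  ≡⟨ size-rect {m} {n} (λ _ → true) (λ _ → true) ⟩
  count {m} (λ _ → true) * count {n} (λ _ → true)  ≡⟨ cong₂ _*_ (count-all m) (count-all n) ⟩
  m * n                    ∎
  where open ≡-Reasoning

size-block≤ : ∀ {m n} (X : VSet m n) R C → size (block X R C) ≤ count R * count C
size-block≤ X R C = ≤-trans (size-mono (λ v → ∧-elimʳ {X v})) (≤-reflexive (size-rect R C))

size-block-compl : ∀ {m n} (S : VSet m n) R C →
  size (block S R C) + size (block (compl S) R C) ≡ count R * count C
size-block-compl S R C =
  trans (sym (size-⊎ (λ v → pointwise (S v) (rect R C v)))) (size-rect R C)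
  where
  pointwise : ∀ s r → 𝟙 r ≡ 𝟙 (s ∧ r) + 𝟙 (not s ∧ r)
  pointwise true  r = sym (+-identityʳ (𝟙 r))
  pointwise false r = refl

size-blocks : ∀ {m n} (X : VSet m n) R C → size X ≡
  size (block X R C) + size (block X R (not ∘ C)) +
  size (block X (not ∘ R) C) + size (block X (not ∘ R) (not ∘ C))
size-blocks X R C = begin
  size X                             ≡⟨ size≡∑V X ⟩
  ∑V (𝟙 ∘ X)                         ≡⟨ ∑V-cong (λ v → split (X v) (R (proj₁ v)) (C (proj₂ v))) ⟩
  ∑V (λ v → b₁ v + b₂ v + b₃ v + b₄ v)  ≡⟨ ∑V-distrib-+ (λ v → b₁ v + b₂ v + b₃ v) b₄ ⟩
  ∑V (λ v → b₁ v + b₂ v + b₃ v) + ∑V b₄  ≡⟨ cong (_+ ∑V b₄) (∑V-distrib-+ (λ v → b₁ v + b₂ v) b₃) ⟩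
  ∑V (λ v → b₁ v + b₂ v) + ∑V b₃ + ∑V b₄  ≡⟨ cong (λ s → s + ∑V b₃ + ∑V b₄) (∑V-distrib-+ b₁ b₂) ⟩
  ∑V b₁ + ∑V b₂ + ∑V b₃ + ∑V b₄      ≡⟨ sym (cong₂ _+_ (cong₂ _+_ (cong₂ _+_ (size≡∑V (block X R C))
                                           (size≡∑V (block X R (not ∘ C)))) (size≡∑V (block X (not ∘ R) C)))
                                           (size≡∑V (block X (not ∘ R) (not ∘ C)))) ⟩
  size (block X R C) + size (block X R (not ∘ C)) +
  size (block X (not ∘ R) C) + size (block X (not ∘ R) (not ∘ C))  ∎
  where
  open ≡-Reasoning
  b₁ b₂ b₃ b₄ : V _ _ → ℕ
  b₁ = 𝟙 ∘ block X R C
  b₂ = 𝟙 ∘ block X R (not ∘ C)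
  b₃ = 𝟙 ∘ block X (not ∘ R) C
  b₄ = 𝟙 ∘ block X (not ∘ R) (not ∘ C)
  split : ∀ x r c → 𝟙 x ≡ 𝟙 (x ∧ (r ∧ c)) + 𝟙 (x ∧ (r ∧ not c)) + 𝟙 (x ∧ (not r ∧ c)) + 𝟙 (x ∧ (not r ∧ not c))
  split false r     c     = refl
  split true  true  true  = refl
  split true  true  false = refl
  split true  false true  = refl
  split true  false false = refl

-- Walks, saturated blocks and components

Adj-sym : ∀ {m n} {u v : V m n} → Adj u v → Adj v u
Adj-sym (inj₁ (i≡i' , j≢j')) = inj₁ (sym i≡i' , j≢j' ∘ sym)
Adj-sym (inj₂ (j≡j' , i≢i')) = inj₂ (sym j≡j' , i≢i' ∘ sym)

module _ {m n} {X : VSet m n} where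

  walk-start : ∀ {u v} → Walk X u v → u ∈ˢ X
  walk-start (here u∈X)     = u∈X
  walk-start (step u∈X _ _) = u∈X

  walk-end : ∀ {u v} → Walk X u v → v ∈ˢ X
  walk-end (here v∈X)    = v∈X
  walk-end (step _ _ w)  = walk-end w

  walk-++ : ∀ {u v w} → Walk X u v → Walk X v w → Walk X u w
  walk-++ (here _)         w′ = w′
  walk-++ (step u∈X uv w)  w′ = step u∈X uv (walk-++ w w′)

  walk-∷ʳ : ∀ {u v w} → Walk X u v → Adj v w → w ∈ˢ X → Walk X u w
  walk-∷ʳ w vw w∈X = walk-++ w (step (walk-end w) vw (here w∈X))

  walk-reverse : ∀ {u v} → Walk X u v → Walk X v u
  walk-reverse (here u∈X)      = here u∈X
  walk-reverse (step u∈X uv w) = walk-∷ʳ (walk-reverse w) (Adj-sym uv) u∈X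

AdjClosed : ∀ {m n} → VSet m n → VSet m n → Set
AdjClosed X D = ∀ u v → u ∈ˢ D → v ∈ˢ X → Adj u v → v ∈ˢ D

walk-restrict : ∀ {m n} {X D : VSet m n} → AdjClosed X D →
  ∀ {u v} → Walk X u v → u ∈ˢ D → Walk D u v
walk-restrict closed (here _)                 u∈D = here u∈D
walk-restrict closed (step {u} {v} _ uv w)    u∈D =
  step u∈D uv (walk-restrict closed w (closed u v u∈D (walk-start w) uv))

connected-from : ∀ {m n} {D : VSet m n} {v₀} → v₀ ∈ˢ D → (∀ v → v ∈ˢ D → Walk D v₀ v) → Connected D
connected-from {v₀ = v₀} v₀∈D walk-to =
  (v₀ , v₀∈D) , λ u v u∈D v∈D → walk-++ (walk-reverse (walk-to u u∈D)) (walk-to v v∈D)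

-- Every vertex of X lies in R × C or in R̄ × C̄.
Saturated : ∀ {m n} → VSet m n → (Fin m → Bool) → (Fin n → Bool) → Set
Saturated X R C = ∀ {i j} → (i , j) ∈ˢ X → R i ≡ C j

saturated-walk : ∀ {m n} {X : VSet m n} {R C} → Saturated X R C →
  ∀ {u v} → Walk X u v → R (proj₁ u) ≡ R (proj₁ v)
saturated-walk sat (here _) = refl
saturated-walk sat (step {_ , _} {_ , _} _ (inj₁ (refl , _)) w) = saturated-walk sat w
saturated-walk {R = R} {C} sat (step {_ , _} {_ , _} u∈X (inj₂ (refl , _)) w) =
  trans (trans (sat u∈X) (sym (sat (walk-start w)))) (saturated-walk sat w)

saturated-⊆ : ∀ {m n} {X Y : VSet m n} {R C} → Y ⊆ˢ X → Saturated X R C → Saturated Y R C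
saturated-⊆ Y⊆X sat y∈Y = sat (Y⊆X _ y∈Y)

saturated-block-closed : ∀ {m n} {X : VSet m n} {R C} → Saturated X R C → AdjClosed X (block X R C)
saturated-block-closed {X = X} {R} {C} sat (i , j) (i' , j') u∈B v∈X uv =
  ∧-intro v∈X (∧-intro Ri' (subst T (sat v∈X) Ri'))
  where
  Ri' : T (R i')
  Ri' = subst T (saturated-walk sat (step (∧-elimˡ u∈B) uv (here v∈X))) (∧-elimˡ (∧-elimʳ {X (i , j)} u∈B))

insert : ∀ {k} → Fin k → (Fin k → Bool) → Fin k → Bool
insert i R i' = ⌊ i' ≟ i ⌋ ∨ R i'

∈-insert : ∀ {k} (i : Fin k) R {i'} → T (insert i R i') → i' ≡ i ⊎ T (R i')
∈-insert i R {i'} p with ∨-elim ⌊ i' ≟ i ⌋ p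
... | inj₁ i'≡i = inj₁ (toWitness i'≡i)
... | inj₂ i'∈R = inj₂ i'∈R

count-insert : ∀ {k} (i : Fin k) R → ¬ T (R i) → count R < count (insert i R)
count-insert i R i∉R =
  count-mono-< (λ i' → ∨-introʳ ⌊ i' ≟ i ⌋) i i∉R (∨-introˡ (fromWitness {a? = i ≟ i} refl))

anyV? : ∀ {m n} {P : V m n → Set} → (∀ v → Dec (P v)) → Dec (∃ P)
anyV? P? with any? (λ i → any? (λ j → P? (i , j)))
... | yes (i , j , p) = yes ((i , j) , p)
... | no ¬p           = no λ { ((i , j) , p) → ¬p (i , j , p) }

record ComponentBlock {m n} (X : VSet m n) (P : Fin m → Bool) (Q : Fin n → Bool) : Set where
  field
    rows        : Fin m → Bool
    cols        : Fin n → Bool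
    isComponent : IsComponent X (block X rows cols)
    saturated   : Saturated X rows cols
    rows⊆       : ∀ i → T (rows i) → T (P i)
    cols⊆       : ∀ j → T (cols j) → T (Q j)

  area : ℕ
  area = count rows * count cols

-- Starting from the row and column of v₀, repeatedly add the row or column of a vertex
-- of X that violates saturation; every row and column added contains a vertex reachable
-- from v₀, so the resulting saturated block is the component of v₀.
module ComponentThrough {m n} (X : VSet m n) (i₀ : Fin m) (j₀ : Fin n) (v₀∈X : (i₀ , j₀) ∈ˢ X) where

  Reaches : V m n → Set
  Reaches = Walk X (i₀ , j₀)

  record Reached (R : Fin m → Bool) (C : Fin n → Bool) : Set where
    field
      i₀∈R : T (R i₀)
      j₀∈C : T (C j₀)
      row-reached : ∀ {i} → T (R i) → ∃[ j ] Reaches (i , j)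
      col-reached : ∀ {j} → T (C j) → ∃[ i ] Reaches (i , j)
  open Reached

  reaches-along-row : ∀ {i j j'} → Reaches (i , j') → (i , j) ∈ˢ X → Reaches (i , j)
  reaches-along-row {j = j} {j'} w x with j' ≟ j
  ... | yes refl  = w
  ... | no  j'≢j  = walk-∷ʳ w (inj₁ (refl , j'≢j)) x

  reaches-along-col : ∀ {i i' j} → Reaches (i' , j) → (i , j) ∈ˢ X → Reaches (i , j)
  reaches-along-col {i} {i'} w x with i' ≟ i
  ... | yes refl  = w
  ... | no  i'≢i  = walk-∷ʳ w (inj₂ (refl , i'≢i)) x

  start : Reached (λ i → ⌊ i ≟ i₀ ⌋) (λ j → ⌊ j ≟ j₀ ⌋)
  start = record
    { i₀∈R = fromWitness {a? = i₀ ≟ i₀} refl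
    ; j₀∈C = fromWitness {a? = j₀ ≟ j₀} refl
    ; row-reached = λ {i} i≡i₀ → j₀ , subst (λ i → Reaches (i , j₀)) (sym (toWitness i≡i₀)) (here v₀∈X)
    ; col-reached = λ {j} j≡j₀ → i₀ , subst (λ j → Reaches (i₀ , j)) (sym (toWitness j≡j₀)) (here v₀∈X)
    }

  add-col : ∀ {R C i j} → Reached R C → (i , j) ∈ˢ X → T (R i) → Reached R (insert j C)
  add-col {R} {C} {i} {j} r x i∈R = record
    { i₀∈R = i₀∈R r ; j₀∈C = ∨-introʳ _ (j₀∈C r) ; row-reached = row-reached r ; col-reached = reached }
    where
    reached : ∀ {j'} → T (insert j C j') → ∃[ i' ] Reaches (i' , j')
    reached p with ∈-insert j C p
    ... | inj₁ refl  = i , reaches-along-row (proj₂ (row-reached r i∈R)) x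
    ... | inj₂ j'∈C  = col-reached r j'∈C

  add-row : ∀ {R C i j} → Reached R C → (i , j) ∈ˢ X → T (C j) → Reached (insert i R) C
  add-row {R} {C} {i} {j} r x j∈C = record
    { i₀∈R = ∨-introʳ _ (i₀∈R r) ; j₀∈C = j₀∈C r ; row-reached = reached ; col-reached = col-reached r }
    where
    reached : ∀ {i'} → T (insert i R i') → ∃[ j' ] Reaches (i' , j')
    reached p with ∈-insert i R p
    ... | inj₁ refl  = j , reaches-along-col (proj₂ (col-reached r j∈C)) x
    ... | inj₂ i'∈R  = row-reached r i'∈R

  grow : ∀ R C → Reached R C →
    Saturated X R C ⊎ Σ (Fin m → Bool) λ R' → Σ (Fin n → Bool) λ C' →
      Reached R' C' × count R + count C < count R' + count C'
  grow R C r with anyV? (λ v → T? (X v) ×-dec ¬? (R (proj₁ v) ≟ᵇ C (proj₂ v)))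
  ... | no none = inj₁ saturated
    where
    saturated : Saturated X R C
    saturated {i} {j} x with R i ≟ᵇ C j
    ... | yes Ri≡Cj = Ri≡Cj
    ... | no  Ri≢Cj = ⊥-elim (none ((i , j) , x , Ri≢Cj))
  ... | yes ((i , j) , x , Ri≢Cj) with T? (R i) | T? (C j)
  ...   | yes i∈R | yes j∈C = ⊥-elim (Ri≢Cj (T-ext (λ _ → j∈C) (λ _ → i∈R)))
  ...   | no  i∉R | no  j∉C = ⊥-elim (Ri≢Cj (T-ext (⊥-elim ∘ i∉R) (⊥-elim ∘ j∉C)))
  ...   | yes i∈R | no  j∉C = inj₂ (R , insert j C , add-col r x i∈R , +-monoʳ-< (count R) (count-insert j C j∉C))
  ...   | no  i∉R | yes j∈C = inj₂ (insert i R , C , add-row r x j∈C , +-monoˡ-< (count C) (count-insert i R i∉R))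

  saturate : ∀ fuel R C → Reached R C → m + n < fuel + (count R + count C) →
    Σ (Fin m → Bool) λ R' → Σ (Fin n → Bool) λ C' → Reached R' C' × Saturated X R' C'
  saturate zero R C r bound = ⊥-elim (<⇒≱ bound (+-mono-≤ (count≤ R) (count≤ C)))
  saturate (suc fuel) R C r bound with grow R C r
  ... | inj₁ sat = R , C , r , sat
  ... | inj₂ (R' , C' , r' , growth) = saturate fuel R' C' r'
        (≤-trans bound (≤-trans (≤-reflexive (sym (+-suc fuel _))) (+-monoʳ-≤ fuel growth)))

  reached-block-component : ∀ {R C} → Reached R C → Saturated X R C → IsComponent X (block X R C)
  reached-block-component {R} {C} r sat =
    (λ _ → ∧-elimˡ) , connected-from v₀∈B walk-to , saturated-block-closed sat
    where
    v₀∈B : (i₀ , j₀) ∈ˢ block X R C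
    v₀∈B = ∧-intro v₀∈X (∧-intro (i₀∈R r) (j₀∈C r))
    walk-to : ∀ v → v ∈ˢ block X R C → Walk (block X R C) (i₀ , j₀) v
    walk-to (i , j) v∈B = walk-restrict (saturated-block-closed sat)
      (reaches-along-row (proj₂ (row-reached r (∧-elimˡ (∧-elimʳ {X (i , j)} v∈B)))) (∧-elimˡ v∈B)) v₀∈B

component-through : ∀ {m n} (X : VSet m n) {P Q} → Saturated X P Q →
  ∀ {i₀ j₀} → (i₀ , j₀) ∈ˢ block X P Q →
  Σ (ComponentBlock X P Q) λ B → (i₀ , j₀) ∈ˢ rect (ComponentBlock.rows B) (ComponentBlock.cols B)
component-through {m} {n} X {P} {Q} satPQ {i₀} {j₀} v₀∈B with saturate (suc (m + n)) _ _ start (s≤s (m≤m+n (m + n) _))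
  where open ComponentThrough X i₀ j₀ (∧-elimˡ v₀∈B)
... | R , C , r , sat = record
  { rows = R ; cols = C
  ; isComponent = reached-block-component r sat ; saturated = sat
  ; rows⊆ = λ i i∈R → stays-in-P (proj₂ (row-reached r i∈R))
  ; cols⊆ = λ j j∈C → let w = proj₂ (col-reached r j∈C) in subst T (satPQ (walk-end w)) (stays-in-P w)
  } , ∧-intro (i₀∈R r) (j₀∈C r)
  where
  open ComponentThrough X i₀ j₀ (∧-elimˡ v₀∈B)
  open Reached
  stays-in-P : ∀ {v} → Reaches v → T (P (proj₁ v))
  stays-in-P w = subst T (saturated-walk satPQ w) (∧-elimˡ (∧-elimʳ {X (i₀ , j₀)} v₀∈B))

min-area≤cross : ∀ a b a' b' p q → a' ≤ p → b' ≤ q → (a * b) ⊓ (a' * b') ≤ a * q + p * b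
min-area≤cross a b a' b' p q a'≤p b'≤q with ≤-total a a'
... | inj₁ a≤a' = ≤-trans (m⊓n≤m _ _) (≤-trans (*-monoˡ-≤ b (≤-trans a≤a' a'≤p)) (m≤n+m _ _))
... | inj₂ a'≤a = ≤-trans (m⊓n≤n _ _) (≤-trans (*-mono-≤ a'≤a b'≤q) (m≤m+n _ _))

-- d = |D| for a block D with a rows and b columns; t, a', b' are the same data for a
-- block inside the remaining p rows and q columns.
block-merge-inequality : ∀ a b a' b' p q d t → a' ≤ p → b' ≤ q → d ≤ a * b →
  t + t ≤ a' * b' + p * q →
  (d + t) + (d + t) ≤ a * b + (a + p) * (b + q) ⊎
  (d + t) + (d + t) ≤ a' * b' + (a + p) * (b + q)
block-merge-inequality a b a' b' p q d t a'≤p b'≤q d≤ab 2t≤ = choose (≤-total (a' * b') (a * b))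
  where
  open ≤-Reasoning
  both : (d + t) + (d + t) ≤ a * b + a' * b' + (a * b + p * q)
  both = begin
    (d + t) + (d + t)                   ≡⟨ solve (d ∷ t ∷ []) ⟩
    d + d + (t + t)                     ≤⟨ +-mono-≤ (+-mono-≤ d≤ab d≤ab) 2t≤ ⟩
    a * b + a * b + (a' * b' + p * q)   ≡⟨ solve (a ∷ b ∷ a' ∷ b' ∷ p ∷ q ∷ []) ⟩
    a * b + a' * b' + (a * b + p * q)   ∎
  min≤cross = min-area≤cross a b a' b' p q a'≤p b'≤q
  choose : a' * b' ≤ a * b ⊎ a * b ≤ a' * b' →
    (d + t) + (d + t) ≤ a * b + (a + p) * (b + q) ⊎
    (d + t) + (d + t) ≤ a' * b' + (a + p) * (b + q)
  choose (inj₁ a'b'≤ab) = inj₁ (begin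
    (d + t) + (d + t)                           ≤⟨ both ⟩
    a * b + a' * b' + (a * b + p * q)           ≤⟨ +-monoˡ-≤ _ (+-monoʳ-≤ (a * b) (subst (_≤ _) (m≥n⇒m⊓n≡n a'b'≤ab) min≤cross)) ⟩
    a * b + (a * q + p * b) + (a * b + p * q)   ≡⟨ solve (a ∷ b ∷ p ∷ q ∷ []) ⟩
    a * b + (a + p) * (b + q)                   ∎)
  choose (inj₂ ab≤a'b') = inj₂ (begin
    (d + t) + (d + t)                           ≤⟨ both ⟩
    a * b + a' * b' + (a * b + p * q)           ≤⟨ +-monoˡ-≤ _ (+-monoˡ-≤ (a' * b') (subst (_≤ _) (m≤n⇒m⊓n≡m ab≤a'b') min≤cross)) ⟩
    a * q + p * b + a' * b' + (a * b + p * q)   ≡⟨ solve (a ∷ b ∷ a' ∷ b' ∷ p ∷ q ∷ []) ⟩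
    a' * b' + (a + p) * (b + q)                 ∎)

weaken-block : ∀ {m n} {X : VSet m n} {P P' Q Q'} → (∀ i → T (P' i) → T (P i)) → (∀ j → T (Q' j) → T (Q j)) →
  ComponentBlock X P' Q' → ComponentBlock X P Q
weaken-block P'⊆P Q'⊆Q B = record
  { rows = rows ; cols = cols ; isComponent = isComponent ; saturated = saturated
  ; rows⊆ = λ i → P'⊆P i ∘ rows⊆ i ; cols⊆ = λ j → Q'⊆Q j ∘ cols⊆ j }
  where open ComponentBlock B

count-split : ∀ {k} {R P : Fin k → Bool} → (∀ i → T (R i) → T (P i)) →
  count P ≡ count R + count (λ i → P i ∧ not (R i))
count-split {R = R} {P} R⊆P =
  trans (sum-cong-≗ (λ i → pointwise (R i) (P i) (R⊆P i))) (∑-distrib-+ (𝟙 ∘ R) _)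
  where
  pointwise : ∀ r p → (T r → T p) → 𝟙 p ≡ 𝟙 r + 𝟙 (p ∧ not r)
  pointwise true  true  _   = refl
  pointwise true  false r⇒p = ⊥-elim (r⇒p tt)
  pointwise false true  _   = refl
  pointwise false false _   = refl

-- The mixed blocks R × (Q ∖ C) and (P ∖ R) × C contain no vertex of X.
size-block-split : ∀ {m n} (X : VSet m n) {P Q R C} → Saturated X R C →
  (∀ i → T (R i) → T (P i)) → (∀ j → T (C j) → T (Q j)) →
  size (block X P Q) ≡ size (block X R C) + size (block X (λ i → P i ∧ not (R i)) (λ j → Q j ∧ not (C j)))
size-block-split X {P} {Q} {R} {C} sat R⊆P C⊆Q =
  size-⊎ λ { (i , j) → pointwise (X (i , j)) (R i) (C j) (P i) (Q j) sat (R⊆P i) (C⊆Q j) }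
  where
  pointwise : ∀ x r c p q → (T x → r ≡ c) → (T r → T p) → (T c → T q) →
    𝟙 (x ∧ (p ∧ q)) ≡ 𝟙 (x ∧ (r ∧ c)) + 𝟙 (x ∧ ((p ∧ not r) ∧ (q ∧ not c)))
  pointwise false _     _     _     _     _   _   _   = refl
  pointwise true  true  true  true  true  _   _   _   = refl
  pointwise true  true  true  false _     _   r⇒p _   = ⊥-elim (r⇒p tt)
  pointwise true  true  true  true  false _   _   c⇒q = ⊥-elim (c⇒q tt)
  pointwise true  true  false _     _     r≡c _   _   = contradiction (r≡c tt) λ ()
  pointwise true  false true  _     _     r≡c _   _   = contradiction (r≡c tt) λ ()
  pointwise true  false false true  true  _   _   _   = refl
  pointwise true  false false true  false _   _   _   = refl
  pointwise true  false false false _     _   _   _   = refl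

-- Peel off the component through some vertex and recurse on the remaining rows P ∖ R and
-- columns Q ∖ C, keeping whichever of the two blocks has the larger area; fuel bounds the
-- number of rows.
heavy-component : ∀ {m n} (X : VSet m n) fuel P Q → count P ≤ fuel → Saturated X P Q →
  ∃[ v ] v ∈ˢ block X P Q →
  Σ (ComponentBlock X P Q) λ B →
    size (block X P Q) + size (block X P Q) ≤ ComponentBlock.area B + count P * count Q
heavy-component X zero P Q cP≤0 _ (v , v∈B) =
  ⊥-elim (<⇒≱ (∈⇒count-pos P (∧-elimˡ (∧-elimʳ {X v} v∈B))) cP≤0)
heavy-component X (suc fuel) P Q cP≤ satPQ ((i₀ , j₀) , v₀∈B) =
  combine (anyV? (λ v → T? (block X P' Q' v)))
  where
  B = proj₁ (component-through X satPQ v₀∈B)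
  open ComponentBlock B renaming (rows to R; cols to C)
  P' = λ i → P i ∧ not (R i)
  Q' = λ j → Q j ∧ not (C j)
  a = count R
  b = count C
  p = count P'
  q = count Q'
  d = size (block X R C)
  t = size (block X P' Q')
  conclude : ∀ {M} → (d + t) + (d + t) ≤ M + (a + p) * (b + q) →
    size (block X P Q) + size (block X P Q) ≤ M + count P * count Q
  conclude {M} = subst₂ (λ s c → s + s ≤ M + c) (sym (size-block-split X saturated rows⊆ cols⊆))
    (sym (cong₂ _*_ (count-split rows⊆) (count-split cols⊆)))
  i₀∈R = ∧-elimˡ (proj₂ (component-through X satPQ v₀∈B))
  p<count-P : p < count P
  p<count-P = count-mono-< (λ i → ∧-elimˡ) i₀ (λ i₀∈P' → not⁻ (∧-elimʳ {P i₀} i₀∈P') i₀∈R) (rows⊆ i₀ i₀∈R)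
  combine : Dec (∃[ v ] v ∈ˢ block X P' Q') →
    Σ (ComponentBlock X P Q) λ B → size (block X P Q) + size (block X P Q) ≤ ComponentBlock.area B + count P * count Q
  combine (no rest-empty) = B , conclude (begin
    (d + t) + (d + t)          ≡⟨ cong (λ t → (d + t) + (d + t)) (size-empty _ (λ v v∈ → rest-empty (v , v∈))) ⟩
    (d + 0) + (d + 0)          ≡⟨ cong₂ _+_ (+-identityʳ d) (+-identityʳ d) ⟩
    d + d                      ≤⟨ +-mono-≤ (size-block≤ X R C) (≤-trans (size-block≤ X R C) (*-mono-≤ (m≤m+n a p) (m≤m+n b q))) ⟩
    area + (a + p) * (b + q)   ∎)
    where open ≤-Reasoning
  combine (yes rest-nonempty)
    with heavy-component X fuel P' Q' (≤-pred (≤-trans p<count-P cP≤))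
           (λ x → cong₂ (λ u w → u ∧ not w) (satPQ x) (saturated x)) rest-nonempty
  ... | B' , 2t≤ with block-merge-inequality a b _ _ p q d t
                        (count-mono (ComponentBlock.rows⊆ B')) (count-mono (ComponentBlock.cols⊆ B'))
                        (size-block≤ X R C) 2t≤
  ...   | inj₁ via-B  = B , conclude via-B
  ...   | inj₂ via-B' = weaken-block (λ i → ∧-elimˡ) (λ j → ∧-elimˡ) B' , conclude via-B'

cross : ℕ → ℕ → ℕ → ℕ → ℕ
cross a a' b b' = a * b' + a' * b

area-split : ∀ a a' b b' → (a + a') * (b + b') ≡ cross a a' b b' + (a * b + a' * b')
area-split a a' b b' = expanded
  where
  expanded : (a + a') * (b + b') ≡ (a * b' + a' * b) + (a * b + a' * b')
  expanded = solve (a ∷ a' ∷ b ∷ b' ∷ [])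

αterm≡cross+ : ∀ a a' b b' → αterm (a + a') (b + b') a a' b b' ≡
  cross a a' b b' + (⌈ (a * b ⊔ a' * b') ∸ cross a a' b b' /2⌉ ⊔ 1)
αterm≡cross+ a a' b b' rewrite area-split a a' b b' =
  cong₂ _+_ (m+n∸n≡m K A)
    (cong (λ z → ⌈ z /2⌉ ⊔ 1) (trans (cong₂ _∸_ (+-comm M A) (+-comm K A)) ([m+n]∸[m+o]≡n∸o A M K)))
  where
  K = cross a a' b b'
  A = a * b + a' * b'
  M = a * b ⊔ a' * b'

⌈/2⌉≤ : ∀ y x → y ≤ x + x → ⌈ y /2⌉ ≤ x
⌈/2⌉≤ y x y≤2x = ≤-trans (⌈n/2⌉-mono y≤2x) (≤-reflexive (sym (n≡⌈n+n/2⌉ x)))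

≤⌈/2⌉+⌈/2⌉ : ∀ y → y ≤ ⌈ y /2⌉ + ⌈ y /2⌉
≤⌈/2⌉+⌈/2⌉ y = ≤-trans (≤-reflexive (sym (⌊n/2⌋+⌈n/2⌉≡n y))) (+-monoˡ-≤ _ (⌊n/2⌋≤⌈n/2⌉ y))

αterm≤cross+ : ∀ a a' b b' x → 1 ≤ x →
  a * b ≤ cross a a' b b' + (x + x) → a' * b' ≤ cross a a' b b' + (x + x) →
  αterm (a + a') (b + b') a a' b b' ≤ cross a a' b b' + x
αterm≤cross+ a a' b b' x 1≤x A≤ B≤ = begin
  αterm (a + a') (b + b') a a' b b'                   ≡⟨ αterm≡cross+ a a' b b' ⟩
  K + (⌈ (a * b ⊔ a' * b') ∸ K /2⌉ ⊔ 1)               ≤⟨ +-monoʳ-≤ K (⊔-lub (⌈/2⌉≤ _ x (m≤n+o⇒m∸n≤o _ K (⊔-lub A≤ B≤))) 1≤x) ⟩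
  K + x                                               ∎
  where
  open ≤-Reasoning
  K = cross a a' b b'

AlphaAtMost : ℕ → ℕ → ℕ → Set
AlphaAtMost m n s = ∃[ v ] AlphaVal m n v × v ≤ s

alpha-at-most : ∀ a a' b b' → 1 ≤ a → 1 ≤ a' → 1 ≤ b → 1 ≤ b' → ∀ x → 1 ≤ x →
  a * b ≤ cross a a' b b' + (x + x) → a' * b' ≤ cross a a' b b' + (x + x) →
  AlphaAtMost (a + a') (b + b') (cross a a' b b' + x)
alpha-at-most a a' b b' 1≤a 1≤a' 1≤b 1≤b' x 1≤x A≤ B≤ =
  _ , (a , a' , b , b' , 1≤a , 1≤a' , 1≤b , 1≤b' , refl , refl , refl) , αterm≤cross+ a a' b b' x 1≤x A≤ B≤

m+m<n+n⇒m<n : ∀ {u v} → u + u < v + v → u < v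
m+m<n+n⇒m<n u+u<v+v = ≰⇒> λ v≤u → <⇒≱ u+u<v+v (+-mono-≤ v≤u v≤u)

cross≤area : ∀ a b → cross 1 (2 + a) 1 (2 + b) ≤ (2 + a) * (2 + b)
cross≤area a b = begin
  1 * (2 + b) + (2 + a) * 1          ≡⟨ solve (a ∷ b ∷ []) ⟩
  4 + a + b                          ≤⟨ m≤m+n (4 + a + b) (a + b + a * b) ⟩
  4 + a + b + (a + b + a * b)        ≡⟨ solve (a ∷ b ∷ []) ⟩
  (2 + a) * (2 + b)                  ∎
  where open ≤-Reasoning

-- Splitting off a single row and column: the cross term is then m + n − 2.
alpha-at-most-half : ∀ m n s → 3 ≤ m → 3 ≤ n → m * n ≤ s + s → AlphaAtMost m n s
alpha-at-most-half (suc (suc (suc a))) (suc (suc (suc b))) s (s≤s (s≤s (s≤s z≤n))) (s≤s (s≤s (s≤s z≤n))) mn≤2s =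
  subst (AlphaAtMost (3 + a) (3 + b)) (m+[n∸m]≡n K≤s)
    (alpha-at-most 1 (2 + a) 1 (2 + b) (s≤s z≤n) (s≤s z≤n) (s≤s z≤n) (s≤s z≤n) x 1≤x (≤-trans 1≤x (≤-trans (m≤m+n x x) (m≤n+m (x + x) K))) B≤)
  where
  open ≤-Reasoning
  K = cross 1 (2 + a) 1 (2 + b)
  B = (2 + a) * (2 + b)
  x = s ∸ K
  K≤B = cross≤area a b
  total : suc (K + B) ≤ s + s
  total = subst (_≤ s + s) expand mn≤2s
    where
    expand : (3 + a) * (3 + b) ≡ suc ((1 * (2 + b) + (2 + a) * 1) + (2 + a) * (2 + b))
    expand = solve (a ∷ b ∷ [])
  K≤s : K ≤ s
  K≤s = <⇒≤ (m+m<n+n⇒m<n (≤-trans (s≤s (+-monoʳ-≤ K K≤B)) total))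
  B<K+2x : B < K + (x + x)
  B<K+2x = +-cancelˡ-≤ K _ _ (begin
    K + suc B         ≡⟨ +-suc K B ⟩
    suc (K + B)       ≤⟨ total ⟩
    s + s             ≡⟨ cong₂ _+_ (sym (m+[n∸m]≡n K≤s)) (sym (m+[n∸m]≡n K≤s)) ⟩
    (K + x) + (K + x) ≡⟨ regroup K x ⟩
    K + (K + (x + x)) ∎)
    where
    regroup : ∀ u v → (u + v) + (u + v) ≡ u + (u + (v + v))
    regroup u v = solve (u ∷ v ∷ [])
  B≤ = <⇒≤ B<K+2x
  1≤x : 1 ≤ x
  1≤x = m+m<n+n⇒m<n (+-cancelˡ-< K 0 (x + x) (≤-<-trans (≤-reflexive (+-identityʳ K)) (≤-<-trans K≤B B<K+2x)))

-- Lower bound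

lower-bound-arithmetic : ∀ K u₁ u₂ t₁ t₂ → t₁ ≤ K + (u₁ + u₂) →
  (t₁ + t₂) + (t₁ + t₂) ≤ (u₁ + t₁) + (K + ((u₁ + t₁) + (u₂ + t₂))) →
  u₁ + t₁ ≤ K + ((u₁ + u₂) + (u₁ + u₂)) × u₂ + t₂ ≤ K + ((u₁ + u₂) + (u₁ + u₂))
lower-bound-arithmetic K u₁ u₂ t₁ t₂ t₁≤s 2t≤ = first , second
  where
  open ≤-Reasoning
  first = begin
    u₁ + t₁                          ≤⟨ +-monoʳ-≤ u₁ t₁≤s ⟩
    u₁ + (K + (u₁ + u₂))             ≤⟨ ≤-reflexive (regroup K u₁ u₂) ⟩
    K + (u₁ + u₁ + u₂)               ≤⟨ +-monoʳ-≤ K (≤-trans (m≤m+n (u₁ + u₁ + u₂) u₂) (≤-reflexive (regroup′ u₁ u₂))) ⟩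
    K + ((u₁ + u₂) + (u₁ + u₂))      ∎
    where
    regroup : ∀ K u₁ u₂ → u₁ + (K + (u₁ + u₂)) ≡ K + (u₁ + u₁ + u₂)
    regroup K u₁ u₂ = solve (K ∷ u₁ ∷ u₂ ∷ [])
    regroup′ : ∀ u₁ u₂ → u₁ + u₁ + u₂ + u₂ ≡ (u₁ + u₂) + (u₁ + u₂)
    regroup′ u₁ u₂ = solve (u₁ ∷ u₂ ∷ [])
  t₂≤ : t₂ ≤ K + u₁ + u₁ + u₂
  t₂≤ = +-cancelˡ-≤ (t₁ + t₁ + t₂) _ _ (subst₂ _≤_ (regroupˡ t₁ t₂) (regroupʳ K u₁ t₁ u₂ t₂) 2t≤)
    where
    regroupˡ : ∀ t₁ t₂ → (t₁ + t₂) + (t₁ + t₂) ≡ (t₁ + t₁ + t₂) + t₂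
    regroupˡ t₁ t₂ = solve (t₁ ∷ t₂ ∷ [])
    regroupʳ : ∀ K u₁ t₁ u₂ t₂ → (u₁ + t₁) + (K + ((u₁ + t₁) + (u₂ + t₂))) ≡ (t₁ + t₁ + t₂) + (K + u₁ + u₁ + u₂)
    regroupʳ K u₁ t₁ u₂ t₂ = solve (K ∷ u₁ ∷ t₁ ∷ u₂ ∷ t₂ ∷ [])
  second = begin
    u₂ + t₂                          ≤⟨ +-monoʳ-≤ u₂ t₂≤ ⟩
    u₂ + (K + u₁ + u₁ + u₂)          ≡⟨ regroup K u₁ u₂ ⟩
    K + ((u₁ + u₂) + (u₁ + u₂))      ∎
    where
    regroup : ∀ K u₁ u₂ → u₂ + (K + u₁ + u₁ + u₂) ≡ K + ((u₁ + u₂) + (u₁ + u₂))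
    regroup K u₁ u₂ = solve (K ∷ u₁ ∷ u₂ ∷ [])

self-component : ∀ {m n} {S : VSet m n} → Connected S → IsComponent S S
self-component conn = (λ _ v∈S → v∈S) , conn , (λ _ _ _ v∈S _ → v∈S)

-- Any two vertices of K_m □ K_n have distance at most 2.
component-joined : ∀ {m n} {S D : VSet m n} → Connected S → IsComponent (compl S) D → Joined S D
component-joined {S = S} ((s , s∈S) , _) (D⊆T , ((d , d∈D) , _) , D-closed) with s | d | s∈S | d∈D
... | i , j | i' , j' | s∈S | d∈D with i ≟ i' | j ≟ j'
... | yes refl | yes refl = ⊥-elim (not⁻ (D⊆T _ d∈D) s∈S)
... | yes refl | no j≢j'  = (i , j) , (i , j') , s∈S , d∈D , inj₁ (refl , j≢j')
... | no i≢i'  | yes refl = (i , j) , (i' , j) , s∈S , d∈D , inj₂ (refl , i≢i')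
... | no i≢i'  | no j≢j' with T? (S (i , j'))
...   | yes corner∈S = (i , j') , (i' , j') , corner∈S , d∈D , inj₂ (refl , i≢i')
...   | no  corner∉S = (i , j) , (i , j') , s∈S ,
          D-closed (i' , j') (i , j') d∈D (not⁺ corner∉S) (inj₂ (refl , i≢i' ∘ sym)) , inj₁ (refl , j≢j')

component-size≤ : ∀ {m n} {S D : VSet m n} → IsConnectedSafe S → IsComponent (compl S) D → size D ≤ size S
component-size≤ (safe , conn) D-comp = safe _ _ (self-component conn) D-comp (component-joined conn D-comp)

mixed∈ : ∀ {m n} {S : VSet m n} {R C} → Saturated (compl S) R C → ∀ {i j} → R i ≢ C j → (i , j) ∈ˢ S
mixed∈ {S = S} sat {i} {j} Ri≢Cj with T? (S (i , j))
... | yes ij∈S = ij∈S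
... | no  ij∉S = ⊥-elim (Ri≢Cj (sat (not⁺ ij∉S)))

module _ {m n} {R : Fin m → Bool} {C : Fin n → Bool} where

  R×C̄-mixed : ∀ {i j} → T (R i) → T (not (C j)) → R i ≢ C j
  R×C̄-mixed i∈R j∉C Ri≡Cj = not⁻ j∉C (subst T Ri≡Cj i∈R)

  R̄×C-mixed : ∀ {i j} → T (not (R i)) → T (C j) → R i ≢ C j
  R̄×C-mixed i∉R j∈C Ri≡Cj = not⁻ i∉R (subst T (sym Ri≡Cj) j∈C)

size-mixed-block-empty : ∀ {m n} {X : VSet m n} {R C} → Saturated X R C →
  ∀ R' C' → (∀ {i j} → T (R' i) → T (C' j) → R i ≢ C j) → size (block X R' C') ≡ 0
size-mixed-block-empty {X = X} sat R' C' mixed = size-empty _ λ { (i , j) v∈ →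
  mixed (∧-elimˡ (∧-elimʳ {X (i , j)} v∈)) (∧-elimʳ (∧-elimʳ {X (i , j)} v∈)) (sat (∧-elimˡ v∈)) }

size-mixed-block : ∀ {m n} (S : VSet m n) {R C} → Saturated (compl S) R C →
  ∀ R' C' → (∀ {i j} → T (R' i) → T (C' j) → R i ≢ C j) → size (block S R' C') ≡ count R' * count C'
size-mixed-block S sat R' C' mixed = begin
  size (block S R' C')                                ≡⟨ +-identityʳ _ ⟨
  size (block S R' C') + 0                            ≡⟨ cong (size (block S R' C') +_) (size-mixed-block-empty sat R' C' mixed) ⟨
  size (block S R' C') + size (block (compl S) R' C') ≡⟨ size-block-compl S R' C' ⟩
  count R' * count C'                                 ∎
  where open ≡-Reasoning

size-saturated : ∀ {m n} {X : VSet m n} {R C} → Saturated X R C →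
  size X ≡ size (block X R C) + size (block X (not ∘ R) (not ∘ C))
size-saturated {X = X} {R} {C} sat = begin
  size X                                               ≡⟨ size-blocks X R C ⟩
  d₁ + size (block X R (not ∘ C)) + size (block X (not ∘ R) C) + d₂
    ≡⟨ cong₂ (λ x y → d₁ + x + y + d₂) (size-mixed-block-empty sat R (not ∘ C) (R×C̄-mixed {R = R} {C = C}))
                                        (size-mixed-block-empty sat (not ∘ R) C (R̄×C-mixed {R = R} {C = C})) ⟩
  d₁ + 0 + 0 + d₂                                      ≡⟨ cong (_+ d₂) (trans (+-identityʳ _) (+-identityʳ d₁)) ⟩
  d₁ + d₂                                              ∎
  where
  open ≡-Reasoning
  d₁ = size (block X R C)
  d₂ = size (block X (not ∘ R) (not ∘ C))

size-compl-saturated : ∀ {m n} (S : VSet m n) {R C} → Saturated (compl S) R C →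
  size S ≡ cross (count R) (count (not ∘ R)) (count C) (count (not ∘ C)) +
           (size (block S R C) + size (block S (not ∘ R) (not ∘ C)))
size-compl-saturated S {R} {C} sat = begin
  size S                                               ≡⟨ size-blocks S R C ⟩
  d₁ + size (block S R (not ∘ C)) + size (block S (not ∘ R) C) + d₂
    ≡⟨ cong₂ (λ x y → d₁ + x + y + d₂) (size-mixed-block S sat R (not ∘ C) (R×C̄-mixed {R = R} {C = C}))
                                        (size-mixed-block S sat (not ∘ R) C (R̄×C-mixed {R = R} {C = C})) ⟩
  d₁ + count R * count (not ∘ C) + count (not ∘ R) * count C + d₂
    ≡⟨ regroup d₁ (count R * count (not ∘ C)) (count (not ∘ R) * count C) d₂ ⟩
  cross (count R) (count (not ∘ R)) (count C) (count (not ∘ C)) + (d₁ + d₂)  ∎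
  where
  open ≡-Reasoning
  d₁ = size (block S R C)
  d₂ = size (block S (not ∘ R) (not ∘ C))
  regroup : ∀ d₁ p q d₂ → d₁ + p + q + d₂ ≡ (p + q) + (d₁ + d₂)
  regroup d₁ p q d₂ = solve (d₁ ∷ p ∷ q ∷ d₂ ∷ [])

-- If S met neither R × C nor R̄ × C̄, the row label R would be constant along S,
-- but S contains the vertices (i₁ , j₂) and (i₂ , j₁) with different labels.
diagonal-blocks-meet : ∀ {m n} {S : VSet m n} {R C} → Connected S → Saturated (compl S) R C →
  ∀ {i₁ j₁ i₂ j₂} → T (R i₁) → T (C j₁) → ¬ T (R i₂) → ¬ T (C j₂) →
  0 < size (block S R C) + size (block S (not ∘ R) (not ∘ C))
diagonal-blocks-meet {S = S} {R} {C} (_ , walks) sat {i₁} {j₁} {i₂} {j₂} i₁∈R j₁∈C i₂∉R j₂∉C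
  with anyV? (λ v → T? (S v) ×-dec (R (proj₁ v) ≟ᵇ C (proj₂ v)))
... | yes ((i , j) , ij∈S , Ri≡Cj) with T? (R i)
...   | yes i∈R = <-≤-trans (∈⇒size-pos (block S R C) (∧-intro ij∈S (∧-intro i∈R (subst T Ri≡Cj i∈R))))
                    (m≤m+n _ _)
...   | no  i∉R = <-≤-trans (∈⇒size-pos (block S (not ∘ R) (not ∘ C))
                      (∧-intro ij∈S (∧-intro (not⁺ i∉R) (not⁺ (i∉R ∘ subst T (sym Ri≡Cj))))))
                    (m≤n+m _ _)
diagonal-blocks-meet {S = S} {R} {C} (_ , walks) sat {i₁} {j₁} {i₂} {j₂} i₁∈R j₁∈C i₂∉R j₂∉C
  | no none = ⊥-elim (i₂∉R (subst T (saturated-walk S-saturated (walks (i₁ , j₂) (i₂ , j₁) start end)) i₁∈R))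
  where
  S-saturated : Saturated S R (not ∘ C)
  S-saturated {i} {j} ij∈S = ¬-not λ Ri≡Cj → none ((i , j) , ij∈S , Ri≡Cj)
  start : (i₁ , j₂) ∈ˢ S
  start = mixed∈ {S = S} {R} {C} sat {i₁} {j₂} λ Ri₁≡Cj₂ → j₂∉C (subst T Ri₁≡Cj₂ i₁∈R)
  end : (i₂ , j₁) ∈ˢ S
  end = mixed∈ {S = S} {R} {C} sat {i₂} {j₁} λ Ri₂≡Cj₁ → i₂∉R (subst T (sym Ri₂≡Cj₁) j₁∈C)

all : ∀ {k} → Fin k → Bool
all _ = true

lower-bound-from-block : ∀ m n (S : VSet m n) → 3 ≤ m → 3 ≤ n → IsConnectedSafe S →
  (B : ComponentBlock (compl S) all all) →
  size (block (compl S) all all) + size (block (compl S) all all) ≤ ComponentBlock.area B + count {m} all * count {n} all →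
  AlphaAtMost m n (size S)
lower-bound-from-block m n S 3≤m 3≤n cs B heavy = finish (anyV? (λ v → T? (block (compl S) R̄ C̄ v)))
  where
  open ComponentBlock B renaming (rows to R; cols to C)
  open ≤-Reasoning
  R̄ = not ∘ R
  C̄ = not ∘ C
  a = count R
  b = count C
  a' = count R̄
  b' = count C̄
  K = cross a a' b b'
  s = size S
  t₁ = size (block (compl S) R C)
  t₂ = size (block (compl S) R̄ C̄)
  u₁ = size (block S R C)
  u₂ = size (block S R̄ C̄)
  t₁≤s : t₁ ≤ s
  t₁≤s = component-size≤ cs isComponent
  size-T : size (compl S) ≡ t₁ + t₂
  size-T = size-saturated {X = compl S} saturated
  size-S : s ≡ K + (u₁ + u₂)
  size-S = size-compl-saturated S saturated
  mn≡ : count {m} all * count {n} all ≡ K + ((u₁ + t₁) + (u₂ + t₂))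
  mn≡ = begin-equality
    count {m} all * count {n} all   ≡⟨ cong₂ _*_ (trans (count-all m) (sym (count-not R))) (trans (count-all n) (sym (count-not C))) ⟩
    (a + a') * (b + b')             ≡⟨ area-split a a' b b' ⟩
    K + (a * b + a' * b')           ≡⟨ cong₂ (λ x y → K + (x + y)) (size-block-compl S R C) (size-block-compl S R̄ C̄) ⟨
    K + ((u₁ + t₁) + (u₂ + t₂))     ∎
  2t≤ : (t₁ + t₂) + (t₁ + t₂) ≤ (u₁ + t₁) + (K + ((u₁ + t₁) + (u₂ + t₂)))
  2t≤ = subst₂ (λ t x → t + t ≤ x) (trans (size-≗ (λ v → ∧-identityʳ (not (S v)))) size-T)
          (cong₂ _+_ (sym (size-block-compl S R C)) mn≡) heavy
  finish : Dec (∃[ v ] v ∈ˢ block (compl S) R̄ C̄) → AlphaAtMost m n s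
  finish (no R̄C̄-empty) = alpha-at-most-half m n s 3≤m 3≤n (begin
    m * n                   ≡⟨ size-compl S ⟨
    s + size (compl S)      ≡⟨ cong (λ t → s + t) (trans size-T (cong (t₁ +_) (size-empty _ λ v v∈ → R̄C̄-empty (v , v∈)))) ⟩
    s + (t₁ + 0)            ≤⟨ +-monoʳ-≤ s (≤-trans (≤-reflexive (+-identityʳ t₁)) t₁≤s) ⟩
    s + s                   ∎)
  finish (yes ((i₂ , j₂) , w∈)) =
    subst₂ (λ m' n' → AlphaAtMost m' n' s) (count-not R) (count-not C)
      (subst (AlphaAtMost (a + a') (b + b')) (sym size-S)
        (alpha-at-most a a' b b' (∈⇒count-pos R {i₁} i₁∈R) (∈⇒count-pos R̄ {i₂} i₂∉R)
          (∈⇒count-pos C {j₁} j₁∈C) (∈⇒count-pos C̄ {j₂} j₂∉C)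
          (u₁ + u₂) x≥1 (subst (_≤ K + (x + x)) (size-block-compl S R C) A≤)
          (subst (_≤ K + (x + x)) (size-block-compl S R̄ C̄) B≤)))
    where
    x = u₁ + u₂
    D-vertex = proj₁ (proj₂ isComponent)
    i₁ = proj₁ (proj₁ (proj₁ D-vertex))
    j₁ = proj₂ (proj₁ (proj₁ D-vertex))
    i₁∈R = ∧-elimˡ (∧-elimʳ {not (S (i₁ , j₁))} (proj₂ (proj₁ D-vertex)))
    j₁∈C = ∧-elimʳ (∧-elimʳ {not (S (i₁ , j₁))} (proj₂ (proj₁ D-vertex)))
    i₂∉R = ∧-elimˡ (∧-elimʳ {not (S (i₂ , j₂))} w∈)
    j₂∉C = ∧-elimʳ (∧-elimʳ {not (S (i₂ , j₂))} w∈)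
    x≥1 = diagonal-blocks-meet (proj₂ cs) saturated i₁∈R j₁∈C (not⁻ i₂∉R) (not⁻ j₂∉C)
    bounds = lower-bound-arithmetic K u₁ u₂ t₁ t₂ (subst (t₁ ≤_) size-S t₁≤s) 2t≤
    A≤ = proj₁ bounds
    B≤ = proj₂ bounds

lower-bound : ∀ m n (S : VSet m n) → 3 ≤ m → 3 ≤ n → IsConnectedSafe S → AlphaAtMost m n (size S)
lower-bound m n S 3≤m 3≤n cs with anyV? (λ v → T? (compl S v))
... | yes (v , v∈T) = uncurry (lower-bound-from-block m n S 3≤m 3≤n cs)
        (heavy-component (compl S) m all all (count≤ all) (λ _ → refl) (v , ∧-intro v∈T tt))
... | no  T-empty = alpha-at-most-half m n (size S) 3≤m 3≤n (begin
  m * n                      ≡⟨ size-compl S ⟨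
  size S + size (compl S)    ≡⟨ cong (size S +_) (size-empty _ λ v v∈ → T-empty (v , v∈)) ⟩
  size S + 0                 ≤⟨ +-monoʳ-≤ (size S) z≤n ⟩
  size S + size S            ∎)
  where open ≤-Reasoning

-- Construction of connected safe sets

count-singleton : ∀ {k} (i : Fin k) → count (λ i' → ⌊ i' ≟ i ⌋) ≡ 1
count-singleton {suc k} zero    = cong suc (trans (sum-const k 0) (*-zeroʳ k))
count-singleton {suc k} (suc i) =
  trans (sum-cong-≗ {k} λ i' → cong 𝟙 (⌊⌋-map′ (cong suc) suc-injective (i' ≟ i))) (count-singleton i)

singleton : ∀ {m n} → V m n → VSet m n
singleton (i , j) = rect (λ i' → ⌊ i' ≟ i ⌋) (λ j' → ⌊ j' ≟ j ⌋)

size-singleton : ∀ {m n} (w : V m n) → size (singleton w) ≡ 1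
size-singleton (i , j) = trans (size-rect (λ i' → ⌊ i' ≟ i ⌋) (λ j' → ⌊ j' ≟ j ⌋)) (cong₂ _*_ (count-singleton i) (count-singleton j))

∈-singleton : ∀ {m n} (w : V m n) {v} → v ∈ˢ singleton w → v ≡ w
∈-singleton (i , j) {i' , j'} v∈ =
  cong₂ _,_ (toWitness {a? = i' ≟ i} (∧-elimˡ v∈)) (toWitness {a? = j' ≟ j} (∧-elimʳ {⌊ i' ≟ i ⌋} v∈))

subset-of-size : ∀ {m n} (Y : VSet m n) x → x ≤ size Y → Σ (VSet m n) λ X → X ⊆ˢ Y × size X ≡ x
subset-of-size {m} {n} Y zero _ = (λ _ → false) , (λ _ ()) , size-empty {m} {n} (λ _ → false) (λ _ ())
subset-of-size Y (suc x) x<|Y| with subset-of-size Y x (<⇒≤ x<|Y|)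
... | X , X⊆Y , |X|≡x = X' , X'⊆Y , |X'|≡1+x
  where
  Y∖X : VSet _ _
  Y∖X v = Y v ∧ not (X v)
  |Y|≡ : size Y ≡ x + size Y∖X
  |Y|≡ = trans (size-⊎ (λ v → pointwise (Y v) (X v) (X⊆Y v))) (cong (_+ size Y∖X) |X|≡x)
    where
    pointwise : ∀ y x → (T x → T y) → 𝟙 y ≡ 𝟙 x + 𝟙 (y ∧ not x)
    pointwise true  true  _   = refl
    pointwise true  false _   = refl
    pointwise false true  x⇒y = ⊥-elim (x⇒y tt)
    pointwise false false _   = refl
  Y∖X-nonempty : ∃[ v ] v ∈ˢ Y∖X
  Y∖X-nonempty = size-pos⇒∈ Y∖X (+-cancelˡ-< x 0 _ (subst (x + 0 <_) |Y|≡ (subst (_< size Y) (sym (+-identityʳ x)) x<|Y|)))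
  w = proj₁ Y∖X-nonempty
  w∈Y∖X = proj₂ Y∖X-nonempty
  X' : VSet _ _
  X' v = X v ∨ singleton w v
  X'⊆Y : X' ⊆ˢ Y
  X'⊆Y v v∈X' with ∨-elim (X v) v∈X'
  ... | inj₁ v∈X = X⊆Y v v∈X
  ... | inj₂ v≡w = subst (λ u → u ∈ˢ Y) (sym (∈-singleton w v≡w)) (∧-elimˡ w∈Y∖X)
  |X'|≡1+x : size X' ≡ suc x
  |X'|≡1+x = trans (size-⊎ (λ v → pointwise (X v) (singleton w v) (λ v∈X v≡w → not⁻ (∧-elimʳ {Y w} w∈Y∖X)
                       (subst (λ u → u ∈ˢ X) (∈-singleton w v≡w) v∈X))))
               (trans (cong₂ _+_ |X|≡x (size-singleton w)) (+-comm x 1))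
    where
    pointwise : ∀ a b → (T a → T b → ⊥) → 𝟙 (a ∨ b) ≡ 𝟙 a + 𝟙 b
    pointwise true  true  a∩b = ⊥-elim (a∩b tt tt)
    pointwise true  false _   = refl
    pointwise false _     _   = refl

module CrossConstruction {m n} (R : Fin m → Bool) (C : Fin n → Bool) (X : VSet m n) (X⊆RC : X ⊆ˢ rect R C) where

  R̄ = not ∘ R
  C̄ = not ∘ C
  K = cross (count R) (count R̄) (count C) (count C̄)

  S : VSet m n
  S v = X v ∨ (R (proj₁ v) xor C (proj₂ v))

  compl-saturated : Saturated (compl S) R C
  compl-saturated {i} {j} v∉S = pointwise (X (i , j)) (R i) (C j) v∉S
    where
    pointwise : ∀ x r c → T (not (x ∨ (r xor c))) → r ≡ c
    pointwise false true  true  _ = refl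
    pointwise false false false _ = refl

  size-S : size S ≡ K + size X
  size-S = trans (size-compl-saturated S compl-saturated)
                 (cong (K +_) (trans (cong₂ _+_ diagonal (size-empty _ opposite-empty)) (+-identityʳ (size X))))
    where
    diagonal : size (block S R C) ≡ size X
    diagonal = size-≗ λ v → pointwise (X v) (R (proj₁ v)) (C (proj₂ v)) (X⊆RC v)
      where
      pointwise : ∀ x r c → (T x → T (r ∧ c)) → (x ∨ (r xor c)) ∧ (r ∧ c) ≡ x
      pointwise true  true  true  _  = refl
      pointwise true  true  false x⇒ = ⊥-elim (x⇒ tt)
      pointwise true  false _     x⇒ = ⊥-elim (x⇒ tt)
      pointwise false true  true  _  = refl
      pointwise false true  false _  = refl
      pointwise false false true  _  = refl
      pointwise false false false _  = refl
    opposite-empty : ∀ v → ¬ v ∈ˢ block S R̄ C̄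
    opposite-empty (i , j) v∈ = pointwise (X (i , j)) (R i) (C j) (X⊆RC (i , j)) v∈
      where
      pointwise : ∀ x r c → (T x → T (r ∧ c)) → ¬ T ((x ∨ (r xor c)) ∧ (not r ∧ not c))
      pointwise true  true  true  _  ()
      pointwise true  true  false _  ()
      pointwise true  false _     x⇒ _ = x⇒ tt
      pointwise false true  true  _  ()
      pointwise false true  false _  ()
      pointwise false false true  _  ()
      pointwise false false false _  ()

  private
    distinct : ∀ {k} (P : Fin k → Bool) {x y} → T (P x) → ¬ T (P y) → x ≢ y
    distinct P Px ¬Py refl = ¬Py Px

    xor-false : ∀ a b → ¬ T a → ¬ T b → ¬ T (a xor b)
    xor-false true  _    ¬a _  _ = ¬a tt
    xor-false false true _  ¬b _ = ¬b tt

  -- Every vertex of S reaches the hub (i₀ , j₀) ∈ X in at most three steps,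
  -- passing through the row i₀ or the column j₀.
  S-connected : ∀ {i₀ j₀ i₁ j₁} → (i₀ , j₀) ∈ˢ X → ¬ T (R i₁) → ¬ T (C j₁) → Connected S
  S-connected {i₀} {j₀} {i₁} {j₁} hub∈X i₁∉R j₁∉C =
    (hub , hub∈S) , λ u v u∈S v∈S → walk-++ (to-hub u u∈S) (walk-reverse (to-hub v v∈S))
    where
    hub = (i₀ , j₀)
    hub∈S = ∨-introˡ hub∈X
    i₀∈R = ∧-elimˡ (X⊆RC hub hub∈X)
    j₀∈C = ∧-elimʳ {R i₀} (X⊆RC hub hub∈X)
    R×C̄⊆S : ∀ {i j} → T (R i) → ¬ T (C j) → (i , j) ∈ˢ S
    R×C̄⊆S i∈R j∉C = mixed∈ {S = S} {R} {C} compl-saturated λ Ri≡Cj → j∉C (subst T Ri≡Cj i∈R)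
    R̄×C⊆S : ∀ {i j} → ¬ T (R i) → T (C j) → (i , j) ∈ˢ S
    R̄×C⊆S i∉R j∈C = mixed∈ {S = S} {R} {C} compl-saturated λ Ri≡Cj → i∉R (subst T (sym Ri≡Cj) j∈C)
    from-R×C̄ : ∀ {i j} → T (R i) → ¬ T (C j) → Walk S (i , j) hub
    from-R×C̄ {i} {j} i∈R j∉C with i ≟ i₀
    ... | yes refl = step (R×C̄⊆S i∈R j∉C) (inj₁ (refl , distinct C j₀∈C j∉C ∘ sym)) (here hub∈S)
    ... | no  i≢i₀ = step (R×C̄⊆S i∈R j∉C) (inj₂ (refl , i≢i₀))
                       (step (R×C̄⊆S i₀∈R j∉C) (inj₁ (refl , distinct C j₀∈C j∉C ∘ sym)) (here hub∈S))
    from-R̄×C : ∀ {i j} → ¬ T (R i) → T (C j) → Walk S (i , j) hub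
    from-R̄×C {i} {j} i∉R j∈C with j ≟ j₀
    ... | yes refl = step (R̄×C⊆S i∉R j∈C) (inj₂ (refl , distinct R i₀∈R i∉R ∘ sym)) (here hub∈S)
    ... | no  j≢j₀ = step (R̄×C⊆S i∉R j∈C) (inj₁ (refl , j≢j₀))
                       (step (R̄×C⊆S i∉R j₀∈C) (inj₂ (refl , distinct R i₀∈R i∉R ∘ sym)) (here hub∈S))
    to-hub : ∀ v → v ∈ˢ S → Walk S v hub
    to-hub (i , j) v∈S with T? (R i) | T? (C j)
    ... | yes i∈R | yes j∈C = step v∈S (inj₁ (refl , distinct C j∈C j₁∉C)) (from-R×C̄ i∈R j₁∉C)
    ... | yes i∈R | no  j∉C = from-R×C̄ i∈R j∉C
    ... | no  i∉R | yes j∈C = from-R̄×C i∉R j∈C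
    ... | no  i∉R | no  j∉C with ∨-elim (X (i , j)) v∈S
    ...   | inj₁ v∈X = ⊥-elim (i∉R (∧-elimˡ (X⊆RC (i , j) v∈X)))
    ...   | inj₂ mixed = ⊥-elim (xor-false (R i) (C j) i∉R j∉C mixed)

  S-safe : Connected S → count R̄ * count C̄ ≤ count R * count C →
    count R * count C ≤ K + (size X + size X) → IsSafe S
  S-safe conn small≤big big≤ C' D (C'⊆S , ((c , c∈C') , _) , C'-closed) (D⊆T , ((d , d∈D) , D-walks) , _) _ =
    ≤-trans D≤ (≤-trans (≤-reflexive (sym size-S)) (size-mono S⊆C'))
    where
    open ≤-Reasoning
    x = size X
    S⊆C' : S ⊆ˢ C'
    S⊆C' v v∈S = walk-end (walk-restrict C'-closed (proj₂ conn c v (C'⊆S c c∈C') v∈S) c∈C')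
    D-saturated : Saturated D R C
    D-saturated = saturated-⊆ D⊆T compl-saturated
    same-row-label : ∀ v → v ∈ˢ D → R (proj₁ d) ≡ R (proj₁ v)
    same-row-label v v∈D = saturated-walk D-saturated (D-walks d v d∈D v∈D)
    D⊆ : ∀ {R' C'} → (∀ {i j} → (i , j) ∈ˢ D → T (R' i) × T (C' j)) → D ⊆ˢ rect R' C'
    D⊆ inside (i , j) v∈D = ∧-intro (proj₁ (inside v∈D)) (proj₂ (inside v∈D))
    D≤ : size D ≤ K + x
    D≤ with T? (R (proj₁ d))
    ... | yes d∈R = +-cancelʳ-≤ x _ _ (begin
      size D + x            ≤⟨ size-disjoint-⊆ (λ v v∈D v∈X → not⁻ (D⊆T v v∈D) (∨-introˡ v∈X)) (D⊆ inside) X⊆RC ⟩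
      size (rect R C)       ≡⟨ size-rect R C ⟩
      count R * count C     ≤⟨ big≤ ⟩
      K + (x + x)           ≡⟨ +-assoc K x x ⟨
      K + x + x             ∎)
      where
      inside : ∀ {i j} → (i , j) ∈ˢ D → T (R i) × T (C j)
      inside {i} {j} v∈D = let i∈R = subst T (same-row-label (i , j) v∈D) d∈R in
        i∈R , subst T (D-saturated v∈D) i∈R
    ... | no  d∉R = begin
      size D                  ≤⟨ size-mono (D⊆ inside) ⟩
      size (rect R̄ C̄)         ≡⟨ size-rect R̄ C̄ ⟩
      count R̄ * count C̄       ≡⟨ m≥n⇒m⊓n≡n small≤big ⟨
      (count R * count C) ⊓ (count R̄ * count C̄)
        ≤⟨ min-area≤cross (count R) (count C) (count R̄) (count C̄) (count R̄) (count C̄) ≤-refl ≤-refl ⟩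
      K                       ≤⟨ m≤m+n K x ⟩
      K + x                   ∎
      where
      inside : ∀ {i j} → (i , j) ∈ˢ D → T (not (R i)) × T (not (C j))
      inside {i} {j} v∈D = let i∉R = d∉R ∘ subst T (sym (same-row-label (i , j) v∈D)) in
        not⁺ i∉R , not⁺ (i∉R ∘ subst T (sym (D-saturated v∈D)))

upper-bound : ∀ {m n} (R : Fin m → Bool) (C : Fin n → Bool) {a a' b b'} →
  count R ≡ a → count (not ∘ R) ≡ a' → count C ≡ b → count (not ∘ C) ≡ b' →
  0 < a' → 0 < b' → a' * b' ≤ a * b →
  ∀ x → 0 < x → x ≤ a * b → a * b ≤ cross a a' b b' + (x + x) → CSSize m n (cross a a' b b' + x)
upper-bound R C {a} {a'} {b} {b'} refl refl refl refl a'>0 b'>0 small≤big x x>0 x≤ab big≤ =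
  S , (S-safe connected small≤big (subst (λ y → a * b ≤ K + (y + y)) (sym |X|≡x) big≤) , connected) ,
  trans size-S (cong (K +_) |X|≡x)
  where
  X-data = subset-of-size (rect R C) x (subst (x ≤_) (sym (size-rect R C)) x≤ab)
  X = proj₁ X-data
  |X|≡x = proj₂ (proj₂ X-data)
  open CrossConstruction R C X (proj₁ (proj₂ X-data))
  connected : Connected S
  connected = S-connected (proj₂ (size-pos⇒∈ X (subst (0 <_) (sym |X|≡x) x>0)))
    (not⁻ (proj₂ (count-pos⇒∈ (not ∘ R) a'>0))) (not⁻ (proj₂ (count-pos⇒∈ (not ∘ C) b'>0)))

first : ∀ {k} → ℕ → Fin k → Bool
first a i = toℕ i <ᵇ a

count-first : ∀ a a' → count {a + a'} (first a) ≡ a × count {a + a'} (not ∘ first a) ≡ a'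
count-first a a' = count-<ᵇ (a + a') a (m≤m+n a a') ,
  +-cancelˡ-≡ a _ _ (trans (cong (_+ count {a + a'} (not ∘ first a)) (sym (count-<ᵇ (a + a') a (m≤m+n a a'))))
                           (count-not {a + a'} (first a)))

-- The set for a split is built with the larger of the two diagonal blocks as R × C.
split-realized : ∀ a a' b b' → 0 < a → 0 < a' → 0 < b → 0 < b' → ∀ x → 0 < x →
  x ≤ (a * b) ⊔ (a' * b') → a * b ≤ cross a a' b b' + (x + x) → a' * b' ≤ cross a a' b b' + (x + x) →
  CSSize (a + a') (b + b') (cross a a' b b' + x)
split-realized a a' b b' a>0 a'>0 b>0 b'>0 x x>0 x≤max A≤ B≤ with ≤-total (a' * b') (a * b)
... | inj₁ B≤A = upper-bound (first a) (first b) (proj₁ (count-first a a')) (proj₂ (count-first a a'))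
       (proj₁ (count-first b b')) (proj₂ (count-first b b')) a'>0 b'>0 B≤A
       x x>0 (subst (x ≤_) (m≥n⇒m⊔n≡m B≤A) x≤max) A≤
... | inj₂ A≤B = subst (CSSize (a + a') (b + b')) (cong (_+ x) (+-comm (a' * b) (a * b')))
       (upper-bound (not ∘ first a) (not ∘ first b) (proj₂ (count-first a a'))
         (trans (sum-cong-≗ {a + a'} (cong 𝟙 ∘ not-involutive ∘ first a)) (proj₁ (count-first a a')))
         (proj₂ (count-first b b'))
         (trans (sum-cong-≗ {b + b'} (cong 𝟙 ∘ not-involutive ∘ first b)) (proj₁ (count-first b b')))
         a>0 b>0 A≤B x x>0 (subst (x ≤_) (m≤n⇒m⊔n≡n A≤B) x≤max)
         (subst (λ K → a' * b' ≤ K + (x + x)) (+-comm (a * b') (a' * b)) B≤))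

alpha-realized : ∀ {m n v} → AlphaVal m n v → CSSize m n v
alpha-realized (a , a' , b , b' , a>0 , a'>0 , b>0 , b'>0 , refl , refl , refl) =
  subst (CSSize (a + a') (b + b')) (sym (αterm≡cross+ a a' b b'))
    (split-realized a a' b b' a>0 a'>0 b>0 b'>0 x (m≤n⊔m _ 1) x≤M
      (≤-trans (m≤m⊔n (a * b) (a' * b')) M≤) (≤-trans (m≤n⊔m (a * b) (a' * b')) M≤))
  where
  K = cross a a' b b'
  M = (a * b) ⊔ (a' * b')
  x = ⌈ M ∸ K /2⌉ ⊔ 1
  M≤ : M ≤ K + (x + x)
  M≤ = ≤-trans (m≤n+m∸n M K) (+-monoʳ-≤ K (≤-trans (≤⌈/2⌉+⌈/2⌉ (M ∸ K))
         (+-mono-≤ (m≤m⊔n ⌈ M ∸ K /2⌉ 1) (m≤m⊔n ⌈ M ∸ K /2⌉ 1))))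
  x≤M : x ≤ M
  x≤M = ⊔-lub (≤-trans (⌈n/2⌉≤n (M ∸ K)) (m∸n≤m M K))
               (≤-trans (*-mono-≤ a>0 b>0) (m≤m⊔n (a * b) (a' * b')))

-- Minimising over splits

splits : ℕ → ℕ → List (ℕ × ℕ)
splits m n = cartesianProduct (applyUpTo suc (pred m)) (applyUpTo suc (pred n))

α-at : ℕ → ℕ → ℕ × ℕ → ℕ
α-at m n (m₁ , n₁) = αterm m n m₁ (m ∸ m₁) n₁ (n ∸ n₁)

split-at-suc : ∀ {m i} → i < pred m → 0 < m ∸ suc i × suc i + (m ∸ suc i) ≡ m
split-at-suc {suc m} i<m = m<n⇒0<n∸m i<m , cong suc (m+[n∸m]≡n (<⇒≤ i<m))

split-index : ∀ i m₂ → 0 < m₂ → i < pred (suc i + m₂) × m₂ ≡ suc i + m₂ ∸ suc i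
split-index i (suc j) _ = ≤-trans (s≤s (m≤m+n i j)) (≤-reflexive (sym (+-suc i j))) , sym (m+n∸m≡n (suc i) (suc j))

split-valid : ∀ {m n s} → s ∈ splits m n → AlphaVal m n (α-at m n s)
split-valid {m} {n} {m₁ , n₁} s∈ with ∈-cartesianProduct⁻ (applyUpTo suc (pred m)) (applyUpTo suc (pred n)) s∈
... | m₁∈ , n₁∈ with ∈-applyUpTo⁻ suc m₁∈ | ∈-applyUpTo⁻ suc n₁∈
... | i , i< , refl | j , j< , refl =
  suc i , m ∸ suc i , suc j , n ∸ suc j , s≤s z≤n , proj₁ (split-at-suc {m} i<) , s≤s z≤n , proj₁ (split-at-suc {n} j<) ,
  proj₂ (split-at-suc {m} i<) , proj₂ (split-at-suc {n} j<) , refl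

alpha-val⇒split : ∀ {m n v} → AlphaVal m n v → ∃[ s ] s ∈ splits m n × v ≡ α-at m n s
alpha-val⇒split (suc i , m₂ , suc j , n₂ , _ , m₂>0 , _ , n₂>0 , refl , refl , refl)
  with split-index i m₂ m₂>0 | split-index j n₂ n₂>0
... | i< , m₂≡ | j< , n₂≡ =
  (suc i , suc j) , ∈-cartesianProduct⁺ (∈-applyUpTo⁺ suc i<) (∈-applyUpTo⁺ suc j<) ,
  cong₂ (λ m₂' n₂' → αterm (suc i + m₂) (suc j + n₂) (suc i) m₂' (suc j) n₂') m₂≡ n₂≡

alpha-minimum : ∀ m n → 2 ≤ m → 2 ≤ n → ∃[ k ] IsMinimum (AlphaVal m n) k
alpha-minimum m n 2≤m 2≤n = α-at m n best ,
  argmin-all (α-at m n) {P = AlphaVal m n ∘ α-at m n} (split-valid (one-one∈ 2≤m 2≤n)) (All.tabulate split-valid) ,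
  λ v v-val → minimal (alpha-val⇒split v-val)
  where
  best = argmin (α-at m n) (1 , 1) (splits m n)
  one-one∈ : ∀ {m n} → 2 ≤ m → 2 ≤ n → (1 , 1) ∈ splits m n
  one-one∈ (s≤s 1≤m) (s≤s 1≤n) = ∈-cartesianProduct⁺ (∈-applyUpTo⁺ suc 1≤m) (∈-applyUpTo⁺ suc 1≤n)
  minimal : ∀ {v} → ∃[ s ] s ∈ splits m n × v ≡ α-at m n s → α-at m n best ≤ v
  minimal (s , s∈ , refl) = All.lookup (f[argmin]≤f[xs] (1 , 1) (splits m n)) s∈

theorem2p9 : ∀ m n → 3 ≤ m → 3 ≤ n →
    ∃[ k ] (IsMinimum (CSSize m n) k × IsMinimum (AlphaVal m n) k)
theorem2p9 m n 3≤m 3≤n with alpha-minimum m n (<⇒≤ 3≤m) (<⇒≤ 3≤n)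
... | k , k-val , k-min = k , (alpha-realized k-val , k≤size) , (k-val , k-min)
  where
  k≤size : ∀ s → CSSize m n s → k ≤ s
  k≤size s (S , cs , refl) with lower-bound m n S 3≤m 3≤n cs
  ... | v , v-val , v≤s = ≤-trans (k-min v v-val) v≤s
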